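{- There is no cofibration category structure on $\mathsf{DiGraph}$ in which the class of cofibrations contains all cofibrations of digraphs and whose weak equivalences are the homotopy equivalences of digraphs.
   Context: Digraphs: a digraph $X$ is a set $X_V$ with a reflexive binary relation ($x\to y$ an edge); digraph maps are functions on vertices preserving the relation. Induced subgraph: $a\to b$ in $A$ iff in $X$ for $a,b\in A_V$. A path of length $n$ from $x$ to $y$: $x=v_0\to v_1\to\cdots\to v_n=y$. Cofibration of digraphs: an induced subgraph inclusion $A\to X$ with no edges from vertices of $A$ to vertices outside $A$, such that there is a projecting decomposition: a function $\pi$ from the set of vertices of $X$ admitting a path to some vertex of $A$ into $A_V$ such that for any $x\in X_V$, $a\in A_V$ admitting a path from $x$, some minimal-length path from $x$ to $a$ passes through $\pi x$. Box product $X\mathbin{\square}Y$: vertices $X_V\times Y_V$, edge $(x,x')\to(y,y')$ iff ($x\to y$ in $X$ and $x'=y'$) or ($x'\to y'$ in $Y$ and $x=y$). A line digraph of size $n$ is a digraph $I$ with vertices $0,\dots,n$ such that for each $i<n$ exactly the edges $i\to i+1$ or $i+1\to i$ (at least one) are present between consecutive vertices and no other non-degenerate edges. A homotopy from $f$ to $g\colon X\to Y$ is a map $\alpha\colon X\mathbin{\square}I\to Y$ for some line digraph $I$ of size $n$ with $\alpha(-,0)=f$, $\alpha(-,n)=g$. A map $f\colon X\to Y$ is a homotopy equivalence if there is $g\colon Y\to X$ with homotopies $gf\sim\mathrm{id}_X$ and $fg\sim\mathrm{id}_Y$. Cofibration category: a category with cofibrations and weak equivalences satisfying: (C1) identities are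 acyclic cofibrations, both classes closed under composition; (C2) 2-out-of-6 for weak equivalences; (C3) initial object exists and all objects are cofibrant; (C4) pushouts along cofibrations exist and pushouts of (acyclic) cofibrations are (acyclic) cofibrations; (C5) codiagonals factor as cofibration followed by weak equivalence; (C6) small coproducts exist; (C7) transfinite composites of (acyclic) cofibrations are (acyclic) cofibrations. -}

module Defs where

open import Data.Nat using (ℕ; zero; suc; _≤_)
open import Data.Fin using (Fin; zero; suc; fromℕ; inject₁)
open import Data.Product using (Σ; Σ-syntax; _×_; _,_; proj₁; proj₂)
open import Data.Sum using (_⊎_; inj₁; inj₂)
open import Data.Unit using (⊤; tt)
open import Data.Empty using (⊥)
open import Data.Bool using (Bool)
open import Relation.Binary.PropositionalEquality using (_≡_; refl)
open import Induction.WellFounded using (WellFounded)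

record Digraph : Set₁ where
  field
    V : Set
    E : V → V → Set
    E-refl : ∀ x → E x x
open Digraph public

record Hom (X Y : Digraph) : Set where
  constructor hom
  field
    fun : V X → V Y
    pres : ∀ {x y} → E X x y → E Y (fun x) (fun y)
open Hom public

idH : ∀ {X} → Hom X X
idH = hom (λ x → x) (λ e → e)

infixr 9 _∘H_
_∘H_ : ∀ {X Y Z} → Hom Y Z → Hom X Y → Hom X Z
g ∘H f = hom (λ x → fun g (fun f x)) (λ e → pres g (pres f e))

infix 4 _≈H_
_≈H_ : ∀ {X Y} → Hom X Y → Hom X Y → Set
f ≈H g = ∀ x → fun f x ≡ fun g x

data Path (X : Digraph) : ℕ → V X → V X → Set where
  here : ∀ {x} → Path X zero x x
  step : ∀ {n x y z} → E X x y → Path X n y z → Path X (suc n) x z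

data OnPath {X : Digraph} (v : V X) : ∀ {n x y} → Path X n x y → Set where
  start : ∀ {n x y} {p : Path X n x y} → v ≡ x → OnPath v p
  later : ∀ {n x y z} {e : E X x y} {p : Path X n y z} → OnPath v p → OnPath v (step e p)

IsMinimal : ∀ {X n x y} → Path X n x y → Set
IsMinimal {X} {n} {x} {y} p = ∀ m → Path X m x y → n ≤ m

Reaches : ∀ {A X} → Hom A X → V X → Set
Reaches {A} {X} f x = Σ[ a ∈ V A ] Σ[ n ∈ ℕ ] Path X n x (fun f a)

record IsDigraphCofibration {A X : Digraph} (f : Hom A X) : Set where
  field
    injective : ∀ a b → fun f a ≡ fun f b → a ≡ b
    induced : ∀ a b → E X (fun f a) (fun f b) → E A a b
    closed : ∀ a x → E X (fun f a) x → Σ[ b ∈ V A ] fun f b ≡ x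
    π : (x : V X) → Reaches f x → V A
    π-spec : ∀ x (r : Reaches f x) (a : V A) n → Path X n x (fun f a) →
             Σ[ m ∈ ℕ ] Σ[ q ∈ Path X m x (fun f a) ] (IsMinimal q × OnPath (fun f (π x r)) q)

_□_ : Digraph → Digraph → Digraph
X □ Y = record
  { V = V X × V Y
  ; E = λ p q → (E X (proj₁ p) (proj₁ q) × proj₂ p ≡ proj₂ q)
              ⊎ (E Y (proj₂ p) (proj₂ q) × proj₁ p ≡ proj₁ q)
  ; E-refl = λ p → inj₁ (E-refl X (proj₁ p) , refl)
  }

-- orientation of the edge(s) between i and i+1
data Dir : Set where
  fwd bwd both : Dir

Fwd : Dir → Set
Fwd fwd = ⊤
Fwd bwd = ⊥
Fwd both = ⊤

Bwd : Dir → Set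
Bwd fwd = ⊥
Bwd bwd = ⊤
Bwd both = ⊤

Line : (n : ℕ) → (Fin n → Dir) → Digraph
Line n d = record
  { V = Fin (suc n)
  ; E = λ i j → i ≡ j
              ⊎ (Σ[ k ∈ Fin n ] (i ≡ inject₁ k × j ≡ suc k × Fwd (d k)))
              ⊎ (Σ[ k ∈ Fin n ] (j ≡ inject₁ k × i ≡ suc k × Bwd (d k)))
  ; E-refl = λ i → inj₁ refl
  }

Homotopy : ∀ {X Y} → Hom X Y → Hom X Y → Set
Homotopy {X} {Y} f g =
  Σ[ n ∈ ℕ ] Σ[ d ∈ (Fin n → Dir) ] Σ[ α ∈ Hom (X □ Line n d) Y ]
    ((∀ x → fun α (x , zero) ≡ fun f x) × (∀ x → fun α (x , fromℕ n) ≡ fun g x))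

IsHomotopyEquivalence : ∀ {X Y} → Hom X Y → Set
IsHomotopyEquivalence {X} {Y} f =
  Σ[ g ∈ Hom Y X ] (Homotopy (g ∘H f) idH × Homotopy (f ∘H g) idH)

Class : Set₁
Class = ∀ {X Y : Digraph} → Hom X Y → Set

IsInitial : Digraph → Set₁
IsInitial Z = ∀ X → Σ[ u ∈ Hom Z X ] (∀ v → v ≈H u)

record IsPushout {A B C D : Digraph} (f : Hom A B) (g : Hom A C)
                 (j : Hom B D) (k : Hom C D) : Set₁ where
  field
    commutes : j ∘H f ≈H k ∘H g
    universal : ∀ {Z} (h : Hom B Z) (l : Hom C Z) → h ∘H f ≈H l ∘H g →
                Σ[ u ∈ Hom D Z ] (u ∘H j ≈H h × u ∘H k ≈H l)
    unique : ∀ {Z} (u v : Hom D Z) → u ∘H j ≈H v ∘H j → u ∘H k ≈H v ∘H k → u ≈H v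

record IsCoproduct {I : Set} (X : I → Digraph) (S : Digraph)
                   (ι : (i : I) → Hom (X i) S) : Set₁ where
  field
    universal : ∀ {Z} (h : (i : I) → Hom (X i) Z) →
                Σ[ u ∈ Hom S Z ] (∀ i → u ∘H ι i ≈H h i)
    unique : ∀ {Z} (u v : Hom S Z) → (∀ i → u ∘H ι i ≈H v ∘H ι i) → u ≈H v

-- an ordinal λ > 0, presented as a (small) well-ordered set with least element
record WellOrder : Set₁ where
  field
    O : Set
    _<_ : O → O → Set
    <-wf : WellFounded _<_
    <-trans : ∀ {a b c} → a < b → b < c → a < c
    <-tri : ∀ a b → a < b ⊎ a ≡ b ⊎ b < a
    bot : O
    bot-least : ∀ a → a ≡ bot ⊎ bot < a

record Chain (W : WellOrder) : Set₁ where
  open WellOrder W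
  field
    ob : O → Digraph
    mor : ∀ {a b} → a < b → Hom (ob a) (ob b)
    mor-irr : ∀ {a b} (p q : a < b) → mor p ≈H mor q
    mor-comp : ∀ {a b c} (p : a < b) (q : b < c) → mor q ∘H mor p ≈H mor (<-trans p q)

record IsColimitOver {W : WellOrder} (X : Chain W) (P : WellOrder.O W → Set)
                     (Z : Digraph)
                     (c : ∀ a → P a → Hom (Chain.ob X a) Z) : Set₁ where
  open WellOrder W
  open Chain X
  field
    compat : ∀ a b (pa : P a) (pb : P b) (p : a < b) → c b pb ∘H mor p ≈H c a pa
    universal : ∀ {Z'} (c' : ∀ a → P a → Hom (ob a) Z') →
                (∀ a b (pa : P a) (pb : P b) (p : a < b) → c' b pb ∘H mor p ≈H c' a pa) →
                Σ[ u ∈ Hom Z Z' ] (∀ a (pa : P a) → u ∘H c a pa ≈H c' a pa)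
    unique : ∀ {Z'} (u v : Hom Z Z') → (∀ a (pa : P a) → u ∘H c a pa ≈H v ∘H c a pa) → u ≈H v

module _ (W : WellOrder) where
  open WellOrder W

  IsLimitPoint : O → Set
  IsLimitPoint b = (Σ[ a ∈ O ] a < b) × (∀ a → a < b → Σ[ c ∈ O ] (a < c × c < b))

  IsImmediate : O → O → Set
  IsImmediate a b = a < b × (∀ c → a < c → c ≡ b ⊎ b < c)

  IsSmooth : Chain W → Set₁
  IsSmooth X = ∀ b → IsLimitPoint b →
    IsColimitOver X (λ a → a < b) (Chain.ob X b) (λ a p → Chain.mor X p)

TransfiniteClosed : Class → Set₁
TransfiniteClosed K =
  ∀ (W : WellOrder) (X : Chain W) → IsSmooth W X →
  (∀ a b (p : WellOrder._<_ W a b) → IsImmediate W a b → K (Chain.mor X p)) →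
  ∀ Z (c : ∀ a → ⊤ → Hom (Chain.ob X a) Z) → IsColimitOver X (λ _ → ⊤) Z c →
  K (c (WellOrder.bot W) tt)

record IsCofibrationCategory (Cof We : Class) : Set₁ where
  field
    -- classes of maps are classes of maps (invariant under equality of maps)
    Cof-resp : ∀ {X Y} {f g : Hom X Y} → f ≈H g → Cof f → Cof g
    We-resp : ∀ {X Y} {f g : Hom X Y} → f ≈H g → We f → We g
    C1-id-Cof : ∀ {X} → Cof (idH {X})
    C1-id-We : ∀ {X} → We (idH {X})
    C1-comp-Cof : ∀ {X Y Z} {f : Hom X Y} {g : Hom Y Z} → Cof f → Cof g → Cof (g ∘H f)
    C1-comp-We : ∀ {X Y Z} {f : Hom X Y} {g : Hom Y Z} → We f → We g → We (g ∘H f)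
    C2 : ∀ {A B C D} {f : Hom A B} {g : Hom B C} {h : Hom C D} →
         We (g ∘H f) → We (h ∘H g) → We f × We g × We h × We (h ∘H g ∘H f)
    C3 : Σ[ Z ∈ Digraph ] (IsInitial Z × (∀ X (u : Hom Z X) → Cof u))
    C4-exists : ∀ {A B C} (f : Hom A B) (g : Hom A C) → Cof f →
                Σ[ D ∈ Digraph ] Σ[ j ∈ Hom B D ] Σ[ k ∈ Hom C D ] IsPushout f g j k
    C4-Cof : ∀ {A B C D} {f : Hom A B} {g : Hom A C} {j : Hom B D} {k : Hom C D} →
             IsPushout f g j k → Cof f → Cof k
    C4-acyclic : ∀ {A B C D} {f : Hom A B} {g : Hom A C} {j : Hom B D} {k : Hom C D} →
                 IsPushout f g j k → Cof f → We f → Cof k × We k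
    C5 : ∀ X S (ι : Bool → Hom X S) → IsCoproduct (λ _ → X) S ι →
         Σ[ Cyl ∈ Digraph ] Σ[ i ∈ Hom S Cyl ] Σ[ p ∈ Hom Cyl X ]
           (Cof i × We p × (∀ b → (p ∘H i) ∘H ι b ≈H idH))
    C6 : ∀ (I : Set) (X : I → Digraph) →
         Σ[ S ∈ Digraph ] Σ[ ι ∈ ((i : I) → Hom (X i) S) ] IsCoproduct X S ι
    C7-Cof : TransfiniteClosed Cof
    C7-acyclic : TransfiniteClosed (λ f → Cof f × We f)

{-# OPTIONS --safe #-}
module Submission where

open import Defs
open import Data.Product using (Σ; Σ-syntax; _×_; _,_; proj₁; proj₂)
open import Data.Sum using (_⊎_; inj₁; inj₂)
import Data.Sum as Sum
open import Data.Unit using (⊤; tt)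
open import Data.Empty using (⊥-elim)
open import Data.Nat using (ℕ; zero; suc; _+_; _∸_; _≤_; _<_; _⊓_; z≤n; s≤s)
open import Data.Nat.Properties
open import Data.Nat.Induction using (<-wellFounded)
open import Data.Fin using (Fin; zero; suc; fromℕ; inject₁; toℕ)
open import Data.Fin.Properties using (toℕ-inject₁; toℕ-fromℕ)
open import Data.Fin.Induction using (<-weakInduction)
open import Relation.Nullary using (¬_)
open import Relation.Binary.Definitions using (tri<; tri≈; tri>)
open import Relation.Binary.PropositionalEquality using (_≡_; refl; sym; trans; cong; subst)

-- The segments [0, N], with edges i+1 → i, form an ω-sequence whose inclusions are digraph
-- cofibrations and homotopy equivalences ([0, N+1] truncates onto [0, N], and the truncation is
-- one edge away from the identity). Its colimit is the ray ℕ, but the inclusion of the point 0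
-- into the ray is not a homotopy equivalence: along a homotopy of length n a vertex moves at
-- most n steps, so no map with bounded image is homotopic to the identity of the ray. Hence
-- acyclic cofibrations are not closed under transfinite composition (C7).

≈H⇒Homotopy : ∀ {X Y} {f g : Hom X Y} → f ≈H g → Homotopy f g
≈H⇒Homotopy {X} {f = f} f≈g = 0 , (λ ()) , f ∘H proj , (λ _ → refl) , f≈g
  where
  proj : Hom (X □ Line 0 (λ ())) X
  proj = hom proj₁ λ where
    (inj₁ (e , _)) → e
    (inj₂ (_ , refl)) → E-refl X _

edge⇒Homotopy : ∀ {X Y} {f g : Hom X Y} → (∀ x → E Y (fun g x) (fun f x)) → Homotopy f g
edge⇒Homotopy {X} {Y} {f} {g} g→f = 1 , (λ _ → bwd) , hom α α-pres , (λ _ → refl) , (λ _ → refl)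
  where
  α : V X × Fin 2 → V Y
  α (x , zero) = fun f x
  α (x , suc zero) = fun g x
  α-pres : ∀ {p q} → E (X □ Line 1 (λ _ → bwd)) p q → E Y (α p) (α q)
  α-pres {_ , zero} {_ , zero} (inj₁ (e , _)) = pres f e
  α-pres {_ , suc zero} {_ , suc zero} (inj₁ (e , _)) = pres g e
  α-pres {_ , zero} {_ , suc zero} (inj₁ (_ , ()))
  α-pres {_ , suc zero} {_ , zero} (inj₁ (_ , ()))
  α-pres (inj₂ (inj₁ refl , refl)) = E-refl Y _
  α-pres (inj₂ (inj₂ (inj₁ (zero , _ , _ , ())) , _))
  α-pres {x , _} (inj₂ (inj₂ (inj₂ (zero , refl , refl , _)) , refl)) = g→f x

Fwd⊎Bwd : ∀ δ → Fwd δ ⊎ Bwd δ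
Fwd⊎Bwd fwd = inj₁ tt
Fwd⊎Bwd bwd = inj₂ tt
Fwd⊎Bwd both = inj₁ tt

line-adjacent : ∀ {X Y n d} (α : Hom (X □ Line n d) Y) x (k : Fin n) →
                E Y (fun α (x , inject₁ k)) (fun α (x , suc k))
                ⊎ E Y (fun α (x , suc k)) (fun α (x , inject₁ k))
line-adjacent {d = d} α x k =
  Sum.map (λ f → pres α (inj₂ (inj₂ (inj₁ (k , refl , refl , f)) , refl)))
          (λ b → pres α (inj₂ (inj₂ (inj₂ (k , refl , refl , b)) , refl)))
          (Fwd⊎Bwd (d k))

-- Edges point towards 0, so that nothing leaves a segment [0, a] inside a longer one.
Ray : Digraph
Ray = record { V = ℕ ; E = λ i j → i ≡ j ⊎ i ≡ suc j ; E-refl = λ _ → inj₁ refl }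

Seg : ℕ → Digraph
Seg N = record
  { V = Σ ℕ (_≤ N)
  ; E = λ x y → E Ray (proj₁ x) (proj₁ y)
  ; E-refl = λ x → E-refl Ray (proj₁ x)
  }

Seg-≡ : ∀ {N i j} {p : i ≤ N} {q : j ≤ N} → i ≡ j → _≡_ {A = V (Seg N)} (i , p) (j , q)
Seg-≡ {p = p} {q} refl = cong (_ ,_) (≤-irrelevant p q)

Seg↪ : ∀ {a b} → a ≤ b → Hom (Seg a) (Seg b)
Seg↪ a≤b = hom (λ (i , i≤a) → i , ≤-trans i≤a a≤b) (λ e → e)

Seg↪Ray : ∀ N → Hom (Seg N) Ray
Seg↪Ray N = hom proj₁ (λ e → e)

Ray-edge-≤ : ∀ {i j} → E Ray i j → j ≤ i
Ray-edge-≤ (inj₁ refl) = ≤-refl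
Ray-edge-≤ (inj₂ refl) = n≤1+n _

Ray-adjacent-≤ : ∀ {i j c} → i ≤ c → E Ray i j ⊎ E Ray j i → j ≤ suc c
Ray-adjacent-≤ i≤c (inj₁ e) = m≤n⇒m≤1+n (≤-trans (Ray-edge-≤ e) i≤c)
Ray-adjacent-≤ i≤c (inj₂ (inj₁ refl)) = m≤n⇒m≤1+n i≤c
Ray-adjacent-≤ i≤c (inj₂ (inj₂ refl)) = s≤s i≤c

map-Path : ∀ {X Y n x y} (f : Hom X Y) → Path X n x y → Path Y n (fun f x) (fun f y)
map-Path f here = here
map-Path f (step e p) = step (pres f e) (map-Path f p)

Ray-path-bounds : ∀ {n i j} → Path Ray n i j → j ≤ i × i ≤ n + j
Ray-path-bounds here = ≤-refl , ≤-refl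
Ray-path-bounds (step (inj₁ refl) p) =
  let j≤i , i≤n+j = Ray-path-bounds p in j≤i , m≤n⇒m≤1+n i≤n+j
Ray-path-bounds (step (inj₂ refl) p) =
  let j≤i , i≤n+j = Ray-path-bounds p in m≤n⇒m≤1+n j≤i , s≤s i≤n+j

Seg-descent : ∀ {N} k j (p : k + j ≤ N) (q : j ≤ N) → Path (Seg N) k (k + j , p) (j , q)
Seg-descent zero j p q = subst (Path _ 0 _) (Seg-≡ refl) here
Seg-descent (suc k) j p q = step (inj₂ refl) (Seg-descent k j (≤-trans (n≤1+n _) p) q)

Seg-descent-visits : ∀ {N} k j (p : k + j ≤ N) (q : j ≤ N) z (r : z ≤ N) →
                     j ≤ z → z ≤ k + j → OnPath (z , r) (Seg-descent k j p q)
Seg-descent-visits zero j p q z r j≤z z≤j = start (Seg-≡ (≤-antisym z≤j j≤z))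
Seg-descent-visits (suc k) j p q z r j≤z z≤k+j with m≤n⇒m<n∨m≡n z≤k+j
... | inj₂ z≡k+j = start (Seg-≡ z≡k+j)
... | inj₁ z<k+j = later (Seg-descent-visits k j _ q z r j≤z (≤-pred z<k+j))

Seg-shortest-path : ∀ {N i j} (p : i ≤ N) (q : j ≤ N) → j ≤ i →
                    Σ[ path ∈ Path (Seg N) (i ∸ j) (i , p) (j , q) ]
                      (IsMinimal path × ∀ z (r : z ≤ N) → j ≤ z → z ≤ i → OnPath (z , r) path)
Seg-shortest-path {N} {i} {j} p q j≤i = go (i ∸ j) (m∸n+n≡m j≤i) p
  where
  go : ∀ k → k + j ≡ i → (p : i ≤ N) →
       Σ[ path ∈ Path (Seg N) k (i , p) (j , q) ]
         (IsMinimal path × ∀ z (r : z ≤ N) → j ≤ z → z ≤ i → OnPath (z , r) path)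
  go k refl p = Seg-descent k j p q , minimal , Seg-descent-visits k j p q
    where
    minimal : IsMinimal (Seg-descent k j p q)
    minimal m path = +-cancelʳ-≤ j k m (proj₂ (Ray-path-bounds (map-Path (Seg↪Ray N) path)))

Seg↪-isDigraphCofibration : ∀ {a b} (a≤b : a ≤ b) → IsDigraphCofibration (Seg↪ a≤b)
Seg↪-isDigraphCofibration {a} {b} a≤b = record
  { injective = λ _ _ e → Seg-≡ (cong proj₁ e)
  ; induced = λ _ _ e → e
  ; closed = λ (i , i≤a) (j , _) e → (j , ≤-trans (Ray-edge-≤ e) i≤a) , Seg-≡ refl
  ; π = λ (i , _) _ → i ⊓ a , m⊓n≤n i a
  ; π-spec = π-spec
  }
  where
  π-spec : ∀ (x : V (Seg b)) → Reaches (Seg↪ a≤b) x → ∀ (y : V (Seg a)) n →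
           Path (Seg b) n x (fun (Seg↪ a≤b) y) →
           Σ[ m ∈ ℕ ] Σ[ path ∈ Path (Seg b) m x (fun (Seg↪ a≤b) y) ]
             (IsMinimal path × OnPath (fun (Seg↪ a≤b) (proj₁ x ⊓ a , m⊓n≤n (proj₁ x) a)) path)
  π-spec (i , i≤b) _ (j , j≤a) _ path =
    let j≤i = proj₁ (Ray-path-bounds (map-Path (Seg↪Ray b) path))
        shortest , minimal , visits = Seg-shortest-path i≤b (≤-trans j≤a a≤b) j≤i
    in i ∸ j , shortest , minimal , visits (i ⊓ a) _ (⊓-glb j≤i j≤a) (m⊓n≤m i a)

⊓-pres-E-Ray : ∀ {i j} a → E Ray i j → E Ray (i ⊓ a) (j ⊓ a)
⊓-pres-E-Ray a (inj₁ refl) = inj₁ refl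
⊓-pres-E-Ray {j = j} a (inj₂ refl) = suc-⊓ j a
  where
  suc-⊓ : ∀ j a → E Ray (suc j ⊓ a) (j ⊓ a)
  suc-⊓ j zero = inj₁ (sym (⊓-zeroʳ j))
  suc-⊓ zero (suc a) = inj₂ refl
  suc-⊓ (suc j) (suc a) = Sum.map (cong suc) (cong suc) (suc-⊓ j a)

truncate : ∀ a {b} → Hom (Seg b) (Seg a)
truncate a = hom (λ (i , _) → i ⊓ a , m⊓n≤n i a) (⊓-pres-E-Ray a)

≤-suc⇒E-Ray-⊓ : ∀ {i a} → i ≤ suc a → E Ray i (i ⊓ a)
≤-suc⇒E-Ray-⊓ {i} {a} i≤1+a with m≤n⇒m<n∨m≡n i≤1+a
... | inj₁ i<1+a = inj₁ (sym (m≤n⇒m⊓n≡m (≤-pred i<1+a)))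
... | inj₂ refl = inj₂ (cong suc (sym (m≥n⇒m⊓n≡n (n≤1+n a))))

Seg↪-suc-isHomotopyEquivalence : ∀ {a} (a≤1+a : a ≤ suc a) → IsHomotopyEquivalence (Seg↪ a≤1+a)
Seg↪-suc-isHomotopyEquivalence {a} a≤1+a =
  truncate a {suc a} ,
  ≈H⇒Homotopy {f = truncate a ∘H Seg↪ a≤1+a} {g = idH} (λ (i , i≤a) → Seg-≡ (m≤n⇒m⊓n≡m i≤a)) ,
  edge⇒Homotopy {f = Seg↪ a≤1+a ∘H truncate a} {g = idH} (λ (i , i≤1+a) → ≤-suc⇒E-Ray-⊓ i≤1+a)

Bounded : ∀ {X} → Hom X Ray → Set
Bounded {X} f = Σ[ c ∈ ℕ ] (∀ x → fun f x ≤ c)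

Homotopy-pres-Bounded : ∀ {X} {f g : Hom X Ray} → Homotopy f g → Bounded f → Bounded g
Homotopy-pres-Bounded (n , d , α , α₀≡f , αₙ≡g) (c , f≤c) =
  n + c , λ x → subst (_≤ n + c) (αₙ≡g x) (subst (λ t → fun α (x , fromℕ n) ≤ t + c) (toℕ-fromℕ n) (moved x (fromℕ n)))
  where
  moved : ∀ x (i : Fin (suc n)) → fun α (x , i) ≤ toℕ i + c
  moved x = <-weakInduction (λ i → fun α (x , i) ≤ toℕ i + c)
    (subst (_≤ c) (sym (α₀≡f x)) (f≤c x))
    (λ k αₖ≤ → Ray-adjacent-≤ (subst (λ t → fun α (x , inject₁ k) ≤ t + c) (toℕ-inject₁ k) αₖ≤) (line-adjacent α x k))

id-Ray-unbounded : ¬ Bounded (idH {Ray})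
id-Ray-unbounded (c , ≤c) = 1+n≰n (≤c (suc c))

Seg↪Ray-not-HomotopyEquivalence : ∀ N → ¬ IsHomotopyEquivalence (Seg↪Ray N)
Seg↪Ray-not-HomotopyEquivalence N (g , _ , ιg∼id) =
  id-Ray-unbounded (Homotopy-pres-Bounded {f = Seg↪Ray N ∘H g} {g = idH} ιg∼id (N , λ x → proj₂ (fun g x)))

ω : WellOrder
ω = record
  { O = ℕ ; _<_ = _<_ ; <-wf = <-wellFounded ; <-trans = <-trans
  ; <-tri = trichotomy ; bot = 0 ; bot-least = zero-least }
  where
  trichotomy : ∀ a b → a < b ⊎ a ≡ b ⊎ b < a
  trichotomy a b with <-cmp a b
  ... | tri< a<b _ _ = inj₁ a<b
  ... | tri≈ _ a≡b _ = inj₂ (inj₁ a≡b)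
  ... | tri> _ _ b<a = inj₂ (inj₂ b<a)
  zero-least : ∀ a → a ≡ 0 ⊎ 0 < a
  zero-least zero = inj₁ refl
  zero-least (suc a) = inj₂ (s≤s z≤n)

ω-not-limit : ∀ b → ¬ IsLimitPoint ω b
ω-not-limit zero ((_ , ()) , _)
ω-not-limit (suc b) (_ , between) =
  let _ , b<c , c<1+b = between b ≤-refl in <-irrefl refl (<-≤-trans b<c (≤-pred c<1+b))

ω-immediate : ∀ {a b} → IsImmediate ω a b → b ≡ suc a
ω-immediate {a} (a<b , next) with next (suc a) ≤-refl
... | inj₁ 1+a≡b = sym 1+a≡b
... | inj₂ b<1+a = ⊥-elim (<-irrefl refl (<-≤-trans a<b (≤-pred b<1+a)))

Seg-chain : Chain ω
Seg-chain = record
  { ob = Seg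
  ; mor = λ a<b → Seg↪ (<⇒≤ a<b)
  ; mor-irr = λ _ _ _ → Seg-≡ refl
  ; mor-comp = λ _ _ _ → Seg-≡ refl
  }

Seg-chain-smooth : IsSmooth ω Seg-chain
Seg-chain-smooth b limit = ⊥-elim (ω-not-limit b limit)

Ray-colimit : IsColimitOver Seg-chain (λ _ → ⊤) Ray (λ N _ → Seg↪Ray N)
Ray-colimit = record
  { compat = λ _ _ _ _ _ _ → refl
  ; universal = universal
  ; unique = λ u v u≈v i → u≈v i tt (i , ≤-refl)
  }
  where
  universal : ∀ {Z} (c : ∀ N → ⊤ → Hom (Seg N) Z) →
              (∀ a b (_ _ : ⊤) (a<b : a < b) → c b tt ∘H Seg↪ (<⇒≤ a<b) ≈H c a tt) →
              Σ[ u ∈ Hom Ray Z ] (∀ N (_ : ⊤) → u ∘H Seg↪Ray N ≈H c N tt)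
  universal {Z} c c-compat = hom u u-pres , λ N _ → u-agrees N
    where
    u : ℕ → V Z
    u i = fun (c i tt) (i , ≤-refl)
    u-agrees : ∀ N (x : V (Seg N)) → u (proj₁ x) ≡ fun (c N tt) x
    u-agrees N (i , i≤N) with m≤n⇒m<n∨m≡n i≤N
    ... | inj₂ refl = cong (fun (c i tt)) (Seg-≡ refl)
    ... | inj₁ i<N = trans (sym (c-compat i N tt tt i<N (i , ≤-refl))) (cong (fun (c N tt)) (Seg-≡ refl))
    u-pres : ∀ {i j} → E Ray i j → E Z (u i) (u j)
    u-pres (inj₁ refl) = E-refl Z _
    u-pres {i} {j} (inj₂ refl) =
      subst (E Z (u i)) (sym (u-agrees i (j , n≤1+n j))) (pres (c i tt) {i , ≤-refl} {j , n≤1+n j} (inj₂ refl))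

proposition4p8 : ¬ (Σ[ Cof ∈ Class ]
    ((∀ {A X : Digraph} (f : Hom A X) → IsDigraphCofibration f → Cof f)
    × IsCofibrationCategory Cof IsHomotopyEquivalence))
proposition4p8 (Cof , cofibrations⊆Cof , isCofCat) =
  Seg↪Ray-not-HomotopyEquivalence 0
    (proj₂ (C7-acyclic ω Seg-chain Seg-chain-smooth steps Ray (λ N _ → Seg↪Ray N) Ray-colimit))
  where
  open IsCofibrationCategory isCofCat
  steps : ∀ a b (a<b : a < b) → IsImmediate ω a b →
          Cof (Seg↪ (<⇒≤ a<b)) × IsHomotopyEquivalence (Seg↪ (<⇒≤ a<b))
  steps a b a<b immediate with ω-immediate immediate
  ... | refl = cofibrations⊆Cof _ (Seg↪-isDigraphCofibration (<⇒≤ a<b))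
             , Seg↪-suc-isHomotopyEquivalence (<⇒≤ a<b)
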